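{- Let $a$ be an integer and let $\Psi$ be the linear datum with index set $[4]$, $W_1=W_2=\mathbb{F}_p$, $W_3=W_4=\mathbb{F}_p^3$, $V=\mathbb{F}_p^4$, and $\phi_1(x,y,z,w)=x+az+w$, $\phi_2(x,y,z,w)=y+z+aw$, $\phi_3(x,y,z,w)=(x,y,w)$, $\phi_4(x,y,z,w)=(x,y,z)$. Let $\Phi$ be a linear datum and $i,j\in I^\Phi$ with $W^\Phi_i=W^\Phi_j=\mathbb{F}_p$. Then the following are equivalent: (1) there exist a partition $I^\Phi\setminus\{i,j\}=S_1\cup S_2$ and linear maps $\mu_0\colon\mathbb{F}_p^2\to V^\Phi$, $\mu_1,\mu_2\colon\mathbb{F}_p\to V^\Phi$ with $(\phi_i,\phi_j)(\mu_0(u))=u$ for all $u\in\mathbb{F}_p^2$, $(\phi_i,\phi_j)(\mu_1(x))=(ax,x)$, $(\phi_i,\phi_j)(\mu_2(x))=(x,ax)$ for all $x\in\mathbb{F}_p$, and $\phi_\ell\circ\mu_r=0$ for $r=1,2$ and $\ell\in S_r$; (2) there exists a morphism $\Theta\colon\Psi\to\Phi$ respecting $i$ and $j$ with $\alpha^\Theta(i)=1$ and $\alpha^\Theta(j)=2$.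
   Context: Fix a prime $p$. A linear datum $(I,V,(W_\ell),(\phi_\ell))$: finite index set, finite-dimensional $\mathbb{F}_p$-spaces, linear maps $\phi_\ell\colon V\to W_\ell$. With a symbol $*$, $W_*=\{0\}$, $\phi_*=0$: a morphism $\Theta\colon\Psi\to\Phi$ of shape $\alpha\colon I^\Phi\to I^\Psi\cup\{*\}$ is a linear $\theta\colon V^\Psi\to V^\Phi$ with linear maps $\sigma_\ell\colon W^\Psi_{\alpha(\ell)}\to W^\Phi_\ell$ ($\ell\in I^\Phi$) such that $\sigma_\ell\circ\phi^\Psi_{\alpha(\ell)}=\phi^\Phi_\ell\circ\theta$. It respects $\ell$ if $\alpha(\ell)\ne*$, $\alpha(\ell')\ne\alpha(\ell)$ for $\ell'\ne\ell$, $W^\Phi_\ell=W^\Psi_{\alpha(\ell)}$ and $\sigma_\ell=\mathrm{id}$. -}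

module Defs where

open import Data.Nat using (ℕ; zero; suc; NonZero)
open import Data.Nat.DivMod using (_mod_)
open import Data.Integer using (ℤ)
open import Data.Integer.DivMod using (_%ℕ_)
open import Data.Fin using (Fin; zero; suc; toℕ)
open import Data.Maybe using (Maybe; just; nothing)
open import Data.Bool using (Bool; true; false)
open import Data.Product using (Σ; ∃; _×_; _,_)
open import Relation.Binary.PropositionalEquality using (_≡_; _≢_; subst; sym)
open import Relation.Nullary using (¬_)

module Over (p : ℕ) .{{_ : NonZero p}} where

  F : Set
  F = Fin p

  infixl 6 _+F_
  infixl 7 _*F_

  _+F_ : F → F → F
  x +F y = (toℕ x Data.Nat.+ toℕ y) mod p

  _*F_ : F → F → F
  x *F y = (toℕ x Data.Nat.* toℕ y) mod p

  0F 1F : F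
  0F = 0 mod p
  1F = 1 mod p

  ⟦_⟧ : ℤ → F
  ⟦ a ⟧ = (a %ℕ p) mod p

  Vec : ℕ → Set
  Vec n = Fin n → F

  Lin : (n m : ℕ) → Set   -- linear maps F_p^n → F_p^m
  Lin n m = Fin m → Fin n → F

  sumF : ∀ {n} → (Fin n → F) → F
  sumF {zero} f = 0F
  sumF {suc n} f = f zero +F sumF (λ k → f (suc k))

  app : ∀ {n m} → Lin n m → Vec n → Vec m
  app A v r = sumF (λ c → A r c *F v c)

  _∘L_ : ∀ {n m k} → Lin m k → Lin n m → Lin n k
  (B ∘L A) r c = sumF (λ t → B r t *F A t c)

  _≈L_ : ∀ {n m} → Lin n m → Lin n m → Set
  A ≈L B = ∀ r c → A r c ≡ B r c

  zeroL : ∀ {n m} → Lin n m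
  zeroL r c = 0F

  IsId : ∀ {n m} → Lin n m → Set
  IsId {n} {m} A = (n ≡ m) × (∀ r c → (toℕ r ≡ toℕ c → A r c ≡ 1F) × (¬ toℕ r ≡ toℕ c → A r c ≡ 0F))

  -- A linear datum: index set Fin k, V = F_p^dimV, W_ℓ = F_p^(dimW ℓ), φ_ℓ : V → W_ℓ.
  record Datum : Set where
    field
      k    : ℕ
      dimV : ℕ
      dimW : Fin k → ℕ
      φ    : (ℓ : Fin k) → Lin dimV (dimW ℓ)
  open Datum public

  -- W_* = {0}: dimension of W at a shape value (nothing = *)
  dimW* : (Ψ : Datum) → Maybe (Fin (k Ψ)) → ℕ
  dimW* Ψ nothing = 0
  dimW* Ψ (just m) = dimW Ψ m

  φ* : (Ψ : Datum) → (x : Maybe (Fin (k Ψ))) → Lin (dimV Ψ) (dimW* Ψ x)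
  φ* Ψ nothing = zeroL
  φ* Ψ (just m) = φ Ψ m

  record Morphism (Ψ Φ : Datum) : Set where
    field
      α : Fin (k Φ) → Maybe (Fin (k Ψ))
      θ : Lin (dimV Ψ) (dimV Φ)
      σ : (ℓ : Fin (k Φ)) → Lin (dimW* Ψ (α ℓ)) (dimW Φ ℓ)
      comm : ∀ ℓ → (σ ℓ ∘L φ* Ψ (α ℓ)) ≈L (φ Φ ℓ ∘L θ)
  open Morphism public

  Respects : ∀ {Ψ Φ} → Morphism Ψ Φ → Fin (k Φ) → Set
  Respects {Ψ} {Φ} Θ ℓ =
    (Σ (Fin (k Ψ)) λ m → α Θ ℓ ≡ just m)
    × (∀ ℓ' → ℓ' ≢ ℓ → α Θ ℓ' ≢ α Θ ℓ)
    × IsId (σ Θ ℓ)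

  coord : ∀ {d} → d ≡ 1 → Fin d
  coord e = subst Fin (sym e) zero

  -- The datum Ψ_a of the lemma (indices 1,2,3,4 ↦ zero, suc zero, ...; coordinates x,y,z,w)
  Ψa : F → Datum
  Ψa a = record { k = 4 ; dimV = 4 ; dimW = dW ; φ = ph }
    where
      dW : Fin 4 → ℕ
      dW zero = 1
      dW (suc zero) = 1
      dW (suc (suc zero)) = 3
      dW (suc (suc (suc zero))) = 3
      e : ∀ {n} → Fin n → Fin n → F
      e zero zero = 1F
      e (suc r) (suc c) = e r c
      e _ _ = 0F
      x y z w : Fin 4
      x = zero
      y = suc zero
      z = suc (suc zero)
      w = suc (suc (suc zero))
      ph : (ℓ : Fin 4) → Lin 4 (dW ℓ)
      ph zero r zero = 1F
      ph zero r (suc zero) = 0F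
      ph zero r (suc (suc zero)) = a
      ph zero r (suc (suc (suc zero))) = 1F
      ph (suc zero) r zero = 0F
      ph (suc zero) r (suc zero) = 1F
      ph (suc zero) r (suc (suc zero)) = 1F
      ph (suc zero) r (suc (suc (suc zero))) = a
      ph (suc (suc zero)) zero c = e x c
      ph (suc (suc zero)) (suc zero) c = e y c
      ph (suc (suc zero)) (suc (suc zero)) c = e w c
      ph (suc (suc (suc zero))) zero c = e x c
      ph (suc (suc (suc zero))) (suc zero) c = e y c
      ph (suc (suc (suc zero))) (suc (suc zero)) c = e z c

{-# OPTIONS --safe #-}
module Submission where

-- If Θ respects i and j (σ = id), then φ_i ∘ θ = φ_1 and φ_j ∘ θ = φ_2,
-- which is condition (1) for the columns μ0 = (θe_x, θe_y), μ1 = θe_z, μ2 = θe_w; any other ℓ is sent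
-- to 3, 4 or *, and φ_3 kills e_z while φ_4 and φ_* kill e_w, giving the partition with S₁ = α⁻¹(3).
-- Conversely, θ = [μ0 | μ1 | μ2] yields a morphism with α = 1, 2, 3, 4 on i, j, S₁, S₂, the σ_ℓ on S₁
-- and S₂ being φ_ℓ ∘ θ restricted to the coordinates φ_3 resp. φ_4 keep.  Primality enters only through
-- 1 ≠ 0 in F_p, which forces i ≠ j in (1).

open import Defs
open import Algebra.Bundles using (CommutativeSemiring)
open import Data.Nat as ℕ using (ℕ; NonZero; _%_)
open import Data.Nat.DivMod using (_mod_; m%n<n; m<n⇒m%n≡m; %-distribˡ-+; %-distribˡ-*)
import Data.Nat.Properties as ℕ
open import Data.Nat.Primality using (Prime; prime⇒nonTrivial)
open import Data.Integer using (ℤ)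
open import Function.Bundles using (_⇔_; mk⇔)
open import Data.Fin using (Fin; zero; suc; toℕ)
open import Data.Fin.Properties using (toℕ-injective; toℕ-fromℕ<; toℕ<n; _≟_)
open import Data.Bool using (Bool; true; false)
open import Data.Maybe using (Maybe; just; nothing)
open import Data.Product using (Σ; _×_; _,_; proj₁; proj₂)
open import Relation.Nullary using (yes; no; contradiction)
open import Relation.Binary.PropositionalEquality

module ModularArithmetic (p : ℕ) .{{_ : NonZero p}} where
  open Over p

  toℕ-mod : ∀ m → toℕ (m mod p) ≡ m % p
  toℕ-mod m = toℕ-fromℕ< (m%n<n m p)

  toℕ-mod-toℕ : ∀ x → toℕ x mod p ≡ x
  toℕ-mod-toℕ x = toℕ-injective (trans (toℕ-mod (toℕ x)) (m<n⇒m%n≡m (toℕ<n x)))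

  mod-+-hom : ∀ m n → m mod p +F n mod p ≡ (m ℕ.+ n) mod p
  mod-+-hom m n = toℕ-injective (begin
    toℕ ((toℕ (m mod p) ℕ.+ toℕ (n mod p)) mod p) ≡⟨ toℕ-mod _ ⟩
    (toℕ (m mod p) ℕ.+ toℕ (n mod p)) % p        ≡⟨ cong₂ (λ a b → (a ℕ.+ b) % p) (toℕ-mod m) (toℕ-mod n) ⟩
    (m % p ℕ.+ n % p) % p                        ≡⟨ %-distribˡ-+ m n p ⟨
    (m ℕ.+ n) % p                                ≡⟨ toℕ-mod _ ⟨
    toℕ ((m ℕ.+ n) mod p)                        ∎)
    where open ≡-Reasoning

  mod-*-hom : ∀ m n → (m mod p) *F (n mod p) ≡ (m ℕ.* n) mod p
  mod-*-hom m n = toℕ-injective (begin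
    toℕ ((toℕ (m mod p) ℕ.* toℕ (n mod p)) mod p) ≡⟨ toℕ-mod _ ⟩
    (toℕ (m mod p) ℕ.* toℕ (n mod p)) % p        ≡⟨ cong₂ (λ a b → (a ℕ.* b) % p) (toℕ-mod m) (toℕ-mod n) ⟩
    (m % p ℕ.* (n % p)) % p                        ≡⟨ %-distribˡ-* m n p ⟨
    (m ℕ.* n) % p                                ≡⟨ toℕ-mod _ ⟨
    toℕ ((m ℕ.* n) mod p)                        ∎)
    where open ≡-Reasoning

  mod-+F : ∀ m y → m mod p +F y ≡ (m ℕ.+ toℕ y) mod p
  mod-+F m y = trans (cong (m mod p +F_) (sym (toℕ-mod-toℕ y))) (mod-+-hom m (toℕ y))

  +F-mod : ∀ x n → x +F n mod p ≡ (toℕ x ℕ.+ n) mod p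
  +F-mod x n = trans (cong (_+F n mod p) (sym (toℕ-mod-toℕ x))) (mod-+-hom (toℕ x) n)

  mod-*F : ∀ m y → (m mod p) *F y ≡ (m ℕ.* toℕ y) mod p
  mod-*F m y = trans (cong ((m mod p) *F_) (sym (toℕ-mod-toℕ y))) (mod-*-hom m (toℕ y))

  *F-mod : ∀ x n → x *F (n mod p) ≡ (toℕ x ℕ.* n) mod p
  *F-mod x n = trans (cong (_*F (n mod p)) (sym (toℕ-mod-toℕ x))) (mod-*-hom (toℕ x) n)

  +F-assoc : ∀ x y z → x +F y +F z ≡ x +F (y +F z)
  +F-assoc x y z = trans (mod-+F (toℕ x ℕ.+ toℕ y) z)
    (trans (cong (_mod p) (ℕ.+-assoc (toℕ x) (toℕ y) (toℕ z))) (sym (+F-mod x (toℕ y ℕ.+ toℕ z))))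

  *F-assoc : ∀ x y z → x *F y *F z ≡ x *F (y *F z)
  *F-assoc x y z = trans (mod-*F (toℕ x ℕ.* toℕ y) z)
    (trans (cong (_mod p) (ℕ.*-assoc (toℕ x) (toℕ y) (toℕ z))) (sym (*F-mod x (toℕ y ℕ.* toℕ z))))

  +F-identityˡ : ∀ x → 0F +F x ≡ x
  +F-identityˡ x = trans (mod-+F 0 x) (toℕ-mod-toℕ x)

  *F-identityˡ : ∀ x → 1F *F x ≡ x
  *F-identityˡ x = trans (mod-*F 1 x) (trans (cong (_mod p) (ℕ.*-identityˡ (toℕ x))) (toℕ-mod-toℕ x))

  *F-zeroˡ : ∀ x → 0F *F x ≡ 0F
  *F-zeroˡ x = mod-*F 0 x

  *F-distribʳ-+F : ∀ x y z → (y +F z) *F x ≡ y *F x +F z *F x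
  *F-distribʳ-+F x y z = trans (mod-*F (toℕ y ℕ.+ toℕ z) x)
    (trans (cong (_mod p) (ℕ.*-distribʳ-+ (toℕ x) (toℕ y) (toℕ z))) (sym (mod-+-hom _ _)))

  commutativeSemiring : CommutativeSemiring _ _
  commutativeSemiring = record { isCommutativeSemiring = isCommutativeSemiringˡ biased }
    where
      open import Algebra.Structures {A = F} _≡_ using (IsSemigroup)
      open import Algebra.Structures.Biased {A = F} _≡_
      semigroup : ∀ _∙_ → (∀ x y z → (x ∙ y) ∙ z ≡ x ∙ (y ∙ z)) → IsSemigroup _∙_
      semigroup _∙_ assoc = record
        { isMagma = record { isEquivalence = isEquivalence ; ∙-cong = cong₂ _∙_ } ; assoc = assoc }
      biased : IsCommutativeSemiringˡ _+F_ _*F_ 0F 1F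
      biased = record
        { +-isCommutativeMonoid = isCommutativeMonoidˡ (record
          { isSemigroup = semigroup _+F_ +F-assoc
          ; identityˡ = +F-identityˡ
          ; comm = λ x y → cong (_mod p) (ℕ.+-comm (toℕ x) (toℕ y)) })
        ; *-isCommutativeMonoid = isCommutativeMonoidˡ (record
          { isSemigroup = semigroup _*F_ *F-assoc
          ; identityˡ = *F-identityˡ
          ; comm = λ x y → cong (_mod p) (ℕ.*-comm (toℕ x) (toℕ y)) })
        ; distribʳ = *F-distribʳ-+F
        ; zeroˡ = *F-zeroˡ
        }

  1F≢0F : 1 ℕ.< p → 1F ≢ 0F
  1F≢0F 1<p 1F≡0F = ℕ.1+n≢0 (begin
    1       ≡⟨ m<n⇒m%n≡m 1<p ⟨
    1 % p   ≡⟨ toℕ-mod 1 ⟨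
    toℕ 1F  ≡⟨ cong toℕ 1F≡0F ⟩
    toℕ 0F  ≡⟨ toℕ-mod 0 ⟩
    0 % p   ≡⟨ m<n⇒m%n≡m (ℕ.<-trans ℕ.z<s 1<p) ⟩
    0       ∎)
    where open ≡-Reasoning

module Matrices (p : ℕ) .{{_ : NonZero p}} where
  open Over p
  open ModularArithmetic p
  open CommutativeSemiring commutativeSemiring
    using (+-identityˡ; +-identityʳ; *-identityˡ; *-identityʳ; zeroʳ; *-assoc; semiring)
  open import Algebra.Properties.Semiring.Sum semiring
    using (sum; ∑-comm; *-distribˡ-sum; *-distribʳ-sum; sum-cong-≗)

  sumF≡sum : ∀ {n} (f : Fin n → F) → sumF f ≡ sum f
  sumF≡sum {ℕ.zero} f = refl
  sumF≡sum {ℕ.suc n} f = cong (f zero +F_) (sumF≡sum (λ k → f (suc k)))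

  sumF-cong : ∀ {n} {f g : Fin n → F} → (∀ k → f k ≡ g k) → sumF f ≡ sumF g
  sumF-cong {f = f} {g} f≗g = trans (sumF≡sum f) (trans (sum-cong-≗ f≗g) (sym (sumF≡sum g)))

  sumF-comm : ∀ {m n} (f : Fin m → Fin n → F) →
              sumF (λ a → sumF (λ b → f a b)) ≡ sumF (λ b → sumF (λ a → f a b))
  sumF-comm f = begin
    sumF (λ a → sumF (f a))                  ≡⟨ sumF-cong (λ a → sumF≡sum (f a)) ⟩
    sumF (λ a → sum (f a))                   ≡⟨ sumF≡sum (λ a → sum (f a)) ⟩
    sum (λ a → sum (f a))                    ≡⟨ ∑-comm f ⟩
    sum (λ b → sum (λ a → f a b))            ≡⟨ sumF≡sum (λ b → sum (λ a → f a b)) ⟨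
    sumF (λ b → sum (λ a → f a b))           ≡⟨ sumF-cong (λ b → sumF≡sum (λ a → f a b)) ⟨
    sumF (λ b → sumF (λ a → f a b))          ∎
    where open ≡-Reasoning

  *F-distribˡ-sumF : ∀ {n} x (f : Fin n → F) → x *F sumF f ≡ sumF (λ k → x *F f k)
  *F-distribˡ-sumF x f =
    trans (cong (x *F_) (sumF≡sum f)) (trans (*-distribˡ-sum x f) (sym (sumF≡sum (λ k → x *F f k))))

  *F-distribʳ-sumF : ∀ {n} x (f : Fin n → F) → sumF f *F x ≡ sumF (λ k → f k *F x)
  *F-distribʳ-sumF x f =
    trans (cong (_*F x) (sumF≡sum f)) (trans (*-distribʳ-sum x f) (sym (sumF≡sum (λ k → f k *F x))))

  app-∘L : ∀ {n m l} (B : Lin m l) (A : Lin n m) v r → app (B ∘L A) v r ≡ app B (app A v) r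
  app-∘L B A v r = begin
    sumF (λ c → sumF (λ t → B r t *F A t c) *F v c)
      ≡⟨ sumF-cong (λ c → *F-distribʳ-sumF (v c) (λ t → B r t *F A t c)) ⟩
    sumF (λ c → sumF (λ t → B r t *F A t c *F v c))
      ≡⟨ sumF-comm (λ c t → B r t *F A t c *F v c) ⟩
    sumF (λ t → sumF (λ c → B r t *F A t c *F v c))
      ≡⟨ sumF-cong (λ t → sumF-cong (λ c → *-assoc (B r t) (A t c) (v c))) ⟩
    sumF (λ t → sumF (λ c → B r t *F (A t c *F v c)))
      ≡⟨ sumF-cong (λ t → *F-distribˡ-sumF (B r t) (λ c → A t c *F v c)) ⟨
    sumF (λ t → B r t *F sumF (λ c → A t c *F v c))
      ∎
    where open ≡-Reasoning

  app-zero : ∀ {n m} (B : Lin n m) r → app B (λ _ → 0F) r ≡ 0F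
  app-zero B r = trans (sym (*F-distribʳ-sumF 0F (B r))) (zeroʳ (sumF (B r)))

  basis : ∀ {n} → Fin n → Vec n
  basis zero zero = 1F
  basis (suc c) (suc k) = basis c k
  basis _ _ = 0F

  app-basis : ∀ {n m} (B : Lin n m) c r → app B (basis c) r ≡ B r c
  app-basis B zero r =
    trans (cong₂ _+F_ (*-identityʳ (B r zero)) (app-zero (λ r k → B r (suc k)) r)) (+-identityʳ _)
  app-basis B (suc c) r =
    trans (cong₂ _+F_ (zeroʳ (B r zero)) (app-basis (λ r k → B r (suc k)) c r)) (+-identityˡ _)

  ∘L-app₁ : ∀ {m d} (ψ : Lin m d) (μ : Lin 1 m) x r →
            app ψ (app μ x) r ≡ (ψ ∘L μ) r zero *F x zero
  ∘L-app₁ ψ μ x r = trans (sym (app-∘L ψ μ x r)) (+-identityʳ ((ψ ∘L μ) r zero *F x zero))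

  ∘L-app₂ : ∀ {m d} (ψ : Lin m d) (μ : Lin 2 m) u r →
            app ψ (app μ u) r ≡ (ψ ∘L μ) r zero *F u zero +F (ψ ∘L μ) r (suc zero) *F u (suc zero)
  ∘L-app₂ ψ μ u r = trans (sym (app-∘L ψ μ u r))
    (cong ((ψ ∘L μ) r zero *F u zero +F_) (+-identityʳ ((ψ ∘L μ) r (suc zero) *F u (suc zero))))

  ∘L-entry : ∀ {n m d} (ψ : Lin m d) (μ : Lin n m) r c → (ψ ∘L μ) r c ≡ app ψ (app μ (basis c)) r
  ∘L-entry ψ μ r c = trans (sym (app-basis (ψ ∘L μ) c r)) (app-∘L ψ μ (basis c) r)

  coord-unique : ∀ {d} (e : d ≡ 1) (r : Fin d) → r ≡ coord e
  coord-unique refl zero = refl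

  single-row : ∀ {n d} (e : d ≡ 1) (C : Lin n d) {f : Vec n} →
               (∀ s → C (coord e) s ≡ f s) → ∀ r s → C r s ≡ f s
  single-row refl C row zero = row

  id₁ : ∀ {d} → Lin 1 d
  id₁ _ _ = 1F

  id₁-isId : ∀ {d} → d ≡ 1 → IsId (id₁ {d})
  id₁-isId refl = refl , λ { zero zero → (λ _ → refl) , (λ 0≢0 → contradiction refl 0≢0) }

  identity-square : ∀ {n d′ d} (σ : Lin d′ d) → IsId σ → (e : d′ ≡ 1) (B : Lin n d′) →
                    ∀ r s → (σ ∘L B) r s ≡ B (coord e) s
  identity-square σ (refl , σ-entries) refl B zero s = begin
    σ zero zero *F B zero s +F 0F ≡⟨ +-identityʳ (σ zero zero *F B zero s) ⟩
    σ zero zero *F B zero s       ≡⟨ cong (_*F B zero s) (proj₁ (σ-entries zero zero) refl) ⟩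
    1F *F B zero s                ≡⟨ *-identityˡ (B zero s) ⟩
    B zero s                      ∎
    where open ≡-Reasoning

  respected-φ∘θ : ∀ {Ψ Φ} (Θ : Morphism Ψ Φ) ℓ {m} → α Θ ℓ ≡ just m → IsId (σ Θ ℓ) →
                  (e : dimW Ψ m ≡ 1) → ∀ r s → (φ Φ ℓ ∘L θ Θ) r s ≡ φ Ψ m (coord e) s
  respected-φ∘θ {Ψ} Θ ℓ {m} αℓ idσ e r s =
    trans (sym (comm Θ ℓ r s)) (square (α Θ ℓ) αℓ (σ Θ ℓ) idσ r s)
    where
      square : ∀ {d} x → x ≡ just m → (σ′ : Lin (dimW* Ψ x) d) → IsId σ′ →
               ∀ r s → (σ′ ∘L φ* Ψ x) r s ≡ φ Ψ m (coord e) s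
      square _ refl σ′ idσ′ = identity-square σ′ idσ′ e (φ Ψ m)

module MorphismsFromΨa (p : ℕ) .{{_ : NonZero p}} (a : Over.F p) where
  open Over p
  open CommutativeSemiring (ModularArithmetic.commutativeSemiring p)
    using (+-identityˡ; +-identityʳ; *-identityˡ; *-identityʳ; zeroˡ)
  open Matrices p

  Ψ : Datum
  Ψ = Ψa a

  columns-xyw : ∀ {d} → Lin 4 d → Lin 3 d
  columns-xyw M r zero = M r zero
  columns-xyw M r (suc zero) = M r (suc zero)
  columns-xyw M r (suc (suc zero)) = M r (suc (suc (suc zero)))

  columns-xyz : ∀ {d} → Lin 4 d → Lin 3 d
  columns-xyz M r zero = M r zero
  columns-xyz M r (suc zero) = M r (suc zero)
  columns-xyz M r (suc (suc zero)) = M r (suc (suc zero))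

  columns-xyw∘φ₃ : ∀ {d} (M : Lin 4 d) → (∀ r → M r (suc (suc zero)) ≡ 0F) →
                   (columns-xyw M ∘L φ Ψ (suc (suc zero))) ≈L M
  columns-xyw∘φ₃ M Mz r zero = app-basis (columns-xyw M) zero r
  columns-xyw∘φ₃ M Mz r (suc zero) = app-basis (columns-xyw M) (suc zero) r
  columns-xyw∘φ₃ M Mz r (suc (suc zero)) = trans (app-zero (columns-xyw M) r) (sym (Mz r))
  columns-xyw∘φ₃ M Mz r (suc (suc (suc zero))) = app-basis (columns-xyw M) (suc (suc zero)) r

  columns-xyz∘φ₄ : ∀ {d} (M : Lin 4 d) → (∀ r → M r (suc (suc (suc zero))) ≡ 0F) →
                   (columns-xyz M ∘L φ Ψ (suc (suc (suc zero)))) ≈L M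
  columns-xyz∘φ₄ M Mw r zero = app-basis (columns-xyz M) zero r
  columns-xyz∘φ₄ M Mw r (suc zero) = app-basis (columns-xyz M) (suc zero) r
  columns-xyz∘φ₄ M Mw r (suc (suc zero)) = app-basis (columns-xyz M) (suc (suc zero)) r
  columns-xyz∘φ₄ M Mw r (suc (suc (suc zero))) = trans (app-zero (columns-xyz M) r) (sym (Mw r))

  is₃ : Maybe (Fin 4) → Bool
  is₃ (just (suc (suc zero))) = true
  is₃ _ = false

  ∘φ*-kills-z : ∀ {d} x → is₃ x ≡ true → (σ′ : Lin (dimW* Ψ x) d) →
                ∀ r → (σ′ ∘L φ* Ψ x) r (suc (suc zero)) ≡ 0F
  ∘φ*-kills-z (just (suc (suc zero))) _ σ′ r = app-zero σ′ r
  ∘φ*-kills-z nothing () σ′ r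
  ∘φ*-kills-z (just zero) () σ′ r
  ∘φ*-kills-z (just (suc zero)) () σ′ r
  ∘φ*-kills-z (just (suc (suc (suc zero)))) () σ′ r

  ∘φ*-kills-w : ∀ {d} x → is₃ x ≡ false → x ≢ just zero → x ≢ just (suc zero) →
                (σ′ : Lin (dimW* Ψ x) d) → ∀ r → (σ′ ∘L φ* Ψ x) r (suc (suc (suc zero))) ≡ 0F
  ∘φ*-kills-w nothing _ _ _ σ′ r = refl
  ∘φ*-kills-w (just zero) _ x≢1 _ σ′ r = contradiction refl x≢1
  ∘φ*-kills-w (just (suc zero)) _ _ x≢2 σ′ r = contradiction refl x≢2
  ∘φ*-kills-w (just (suc (suc zero))) () _ _ σ′ r
  ∘φ*-kills-w (just (suc (suc (suc zero)))) _ _ _ σ′ r = app-zero σ′ r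

  [_∣_∣_] : ∀ {n} → Lin 2 n → Lin 1 n → Lin 1 n → Lin 4 n
  [ μ₀ ∣ μ₁ ∣ μ₂ ] t zero = μ₀ t zero
  [ μ₀ ∣ μ₁ ∣ μ₂ ] t (suc zero) = μ₀ t (suc zero)
  [ μ₀ ∣ μ₁ ∣ μ₂ ] t (suc (suc zero)) = μ₁ t zero
  [ μ₀ ∣ μ₁ ∣ μ₂ ] t (suc (suc (suc zero))) = μ₂ t zero

  module Conditions (Φ : Datum) (i j : Fin (k Φ)) (ei : dimW Φ i ≡ 1) (ej : dimW Φ j ≡ 1) where

    Splitting : Set
    Splitting =
      Σ (Fin (k Φ) → Bool) λ inS1 →
        Σ (Lin 2 (dimV Φ)) λ μ0 →
        Σ (Lin 1 (dimV Φ)) λ μ1 →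
        Σ (Lin 1 (dimV Φ)) λ μ2 →
          (∀ u → app (φ Φ i) (app μ0 u) (coord ei) ≡ u zero
               × app (φ Φ j) (app μ0 u) (coord ej) ≡ u (suc zero))
          × (∀ x → app (φ Φ i) (app μ1 x) (coord ei) ≡ a *F x zero
               × app (φ Φ j) (app μ1 x) (coord ej) ≡ x zero)
          × (∀ x → app (φ Φ i) (app μ2 x) (coord ei) ≡ x zero
               × app (φ Φ j) (app μ2 x) (coord ej) ≡ a *F x zero)
          × (∀ ℓ → ℓ ≢ i → ℓ ≢ j → inS1 ℓ ≡ true → (φ Φ ℓ ∘L μ1) ≈L zeroL)
          × (∀ ℓ → ℓ ≢ i → ℓ ≢ j → inS1 ℓ ≡ false → (φ Φ ℓ ∘L μ2) ≈L zeroL)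

    RespectingMorphism : Set
    RespectingMorphism =
      Σ (Morphism Ψ Φ) λ Θ → Respects Θ i × Respects Θ j × α Θ i ≡ just zero × α Θ j ≡ just (suc zero)

    -- The map θ common to both conditions: [μ0 | μ1 | μ2] in (1), the θ of Θ in (2).
    record AdmissibleMap : Set where
      field
        inS₁    : Fin (k Φ) → Bool
        map     : Lin 4 (dimV Φ)
        row-i   : ∀ s → (φ Φ i ∘L map) (coord ei) s ≡ φ Ψ zero zero s
        row-j   : ∀ s → (φ Φ j ∘L map) (coord ej) s ≡ φ Ψ (suc zero) zero s
        kills-z : ∀ ℓ → ℓ ≢ i → ℓ ≢ j → inS₁ ℓ ≡ true → ∀ r → (φ Φ ℓ ∘L map) r (suc (suc zero)) ≡ 0F
        kills-w : ∀ ℓ → ℓ ≢ i → ℓ ≢ j → inS₁ ℓ ≡ false → ∀ r → (φ Φ ℓ ∘L map) r (suc (suc (suc zero))) ≡ 0F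

    splitting⇒admissible : Splitting → AdmissibleMap
    splitting⇒admissible (inS₁ , μ₀ , μ₁ , μ₂ , H₀ , H₁ , H₂ , S₁ , S₂) = record
      { inS₁ = inS₁
      ; map = [ μ₀ ∣ μ₁ ∣ μ₂ ]
      ; row-i = row-i
      ; row-j = row-j
      ; kills-z = λ ℓ ℓ≢i ℓ≢j ℓ∈S₁ r → S₁ ℓ ℓ≢i ℓ≢j ℓ∈S₁ r zero
      ; kills-w = λ ℓ ℓ≢i ℓ≢j ℓ∈S₂ r → S₂ ℓ ℓ≢i ℓ≢j ℓ∈S₂ r zero
      }
      where
        row-i : ∀ s → (φ Φ i ∘L [ μ₀ ∣ μ₁ ∣ μ₂ ]) (coord ei) s ≡ φ Ψ zero zero s
        row-i zero = trans (∘L-entry (φ Φ i) μ₀ (coord ei) zero) (proj₁ (H₀ (basis zero)))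
        row-i (suc zero) = trans (∘L-entry (φ Φ i) μ₀ (coord ei) (suc zero)) (proj₁ (H₀ (basis (suc zero))))
        row-i (suc (suc zero)) = trans (∘L-entry (φ Φ i) μ₁ (coord ei) zero)
          (trans (proj₁ (H₁ (basis zero))) (*-identityʳ a))
        row-i (suc (suc (suc zero))) = trans (∘L-entry (φ Φ i) μ₂ (coord ei) zero) (proj₁ (H₂ (basis zero)))

        row-j : ∀ s → (φ Φ j ∘L [ μ₀ ∣ μ₁ ∣ μ₂ ]) (coord ej) s ≡ φ Ψ (suc zero) zero s
        row-j zero = trans (∘L-entry (φ Φ j) μ₀ (coord ej) zero) (proj₂ (H₀ (basis zero)))
        row-j (suc zero) = trans (∘L-entry (φ Φ j) μ₀ (coord ej) (suc zero)) (proj₂ (H₀ (basis (suc zero))))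
        row-j (suc (suc zero)) = trans (∘L-entry (φ Φ j) μ₁ (coord ej) zero) (proj₂ (H₁ (basis zero)))
        row-j (suc (suc (suc zero))) = trans (∘L-entry (φ Φ j) μ₂ (coord ej) zero)
          (trans (proj₂ (H₂ (basis zero))) (*-identityʳ a))

    admissible⇒splitting : AdmissibleMap → Splitting
    admissible⇒splitting A = inS₁ , μ₀ , μ₁ , μ₂
      , (λ u → trans (through-μ₀ (row-i zero) (row-i (suc zero)) u)
                 (trans (cong₂ _+F_ (*-identityˡ (u zero)) (zeroˡ (u (suc zero)))) (+-identityʳ (u zero)))
             , trans (through-μ₀ (row-j zero) (row-j (suc zero)) u)
                 (trans (cong₂ _+F_ (zeroˡ (u zero)) (*-identityˡ (u (suc zero)))) (+-identityˡ (u (suc zero)))))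
      , (λ x → through-μ₁ (row-i (suc (suc zero))) x
             , trans (through-μ₁ (row-j (suc (suc zero))) x) (*-identityˡ (x zero)))
      , (λ x → trans (through-μ₂ (row-i (suc (suc (suc zero)))) x) (*-identityˡ (x zero))
             , through-μ₂ (row-j (suc (suc (suc zero)))) x)
      , (λ ℓ ℓ≢i ℓ≢j ℓ∈S₁ r _ → kills-z ℓ ℓ≢i ℓ≢j ℓ∈S₁ r)
      , (λ ℓ ℓ≢i ℓ≢j ℓ∈S₂ r _ → kills-w ℓ ℓ≢i ℓ≢j ℓ∈S₂ r)
      where
        open AdmissibleMap A
        μ₀ : Lin 2 (dimV Φ)
        μ₀ t zero = map t zero
        μ₀ t (suc zero) = map t (suc zero)
        μ₁ μ₂ : Lin 1 (dimV Φ)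
        μ₁ t _ = map t (suc (suc zero))
        μ₂ t _ = map t (suc (suc (suc zero)))

        through-μ₀ : ∀ {ℓ r c₀ c₁} → (φ Φ ℓ ∘L map) r zero ≡ c₀ → (φ Φ ℓ ∘L map) r (suc zero) ≡ c₁ →
                     ∀ u → app (φ Φ ℓ) (app μ₀ u) r ≡ c₀ *F u zero +F c₁ *F u (suc zero)
        through-μ₀ {ℓ} {r} e₀ e₁ u =
          trans (∘L-app₂ (φ Φ ℓ) μ₀ u r) (cong₂ (λ c₀ c₁ → c₀ *F u zero +F c₁ *F u (suc zero)) e₀ e₁)

        through-μ₁ : ∀ {ℓ r c} → (φ Φ ℓ ∘L map) r (suc (suc zero)) ≡ c →
                     ∀ x → app (φ Φ ℓ) (app μ₁ x) r ≡ c *F x zero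
        through-μ₁ {ℓ} {r} e x = trans (∘L-app₁ (φ Φ ℓ) μ₁ x r) (cong (_*F x zero) e)

        through-μ₂ : ∀ {ℓ r c} → (φ Φ ℓ ∘L map) r (suc (suc (suc zero))) ≡ c →
                     ∀ x → app (φ Φ ℓ) (app μ₂ x) r ≡ c *F x zero
        through-μ₂ {ℓ} {r} e x = trans (∘L-app₁ (φ Φ ℓ) μ₂ x r) (cong (_*F x zero) e)

    morphism⇒admissible : RespectingMorphism → AdmissibleMap
    morphism⇒admissible (Θ , (_ , avoids-i , id-i) , (_ , avoids-j , id-j) , αi , αj) = record
      { inS₁ = λ ℓ → is₃ (α Θ ℓ)
      ; map = θ Θ
      ; row-i = respected-φ∘θ Θ i αi id-i refl (coord ei)
      ; row-j = respected-φ∘θ Θ j αj id-j refl (coord ej)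
      ; kills-z = λ ℓ _ _ ℓ∈S₁ r →
          trans (sym (comm Θ ℓ r (suc (suc zero)))) (∘φ*-kills-z (α Θ ℓ) ℓ∈S₁ (σ Θ ℓ) r)
      ; kills-w = λ ℓ ℓ≢i ℓ≢j ℓ∈S₂ r →
          trans (sym (comm Θ ℓ r (suc (suc (suc zero)))))
            (∘φ*-kills-w (α Θ ℓ) ℓ∈S₂ (λ αℓ → avoids-i ℓ ℓ≢i (trans αℓ (sym αi)))
                                      (λ αℓ → avoids-j ℓ ℓ≢j (trans αℓ (sym αj))) (σ Θ ℓ) r)
      }

    splitting⇒distinct : 1F ≢ 0F → Splitting → i ≢ j
    splitting⇒distinct 1F≢0F (_ , μ₀ , _ , _ , H₀ , _) refl = 1F≢0F (begin
      1F                                              ≡⟨ proj₁ (H₀ (basis zero)) ⟨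
      app (φ Φ i) (app μ₀ (basis zero)) (coord ei)    ≡⟨ cong (app (φ Φ i) (app μ₀ (basis zero)))
                                                              (coord-unique ei (coord ej)) ⟨
      app (φ Φ i) (app μ₀ (basis zero)) (coord ej)    ≡⟨ proj₂ (H₀ (basis zero)) ⟩
      0F                                              ∎)
      where open ≡-Reasoning

    module _ (i≢j : i ≢ j) (A : AdmissibleMap) where
      open AdmissibleMap A

      data Role (ℓ : Fin (k Φ)) : Set where
        is-i  : ℓ ≡ i → Role ℓ
        is-j  : ℓ ≡ j → Role ℓ
        in-S₁ : ℓ ≢ i → ℓ ≢ j → inS₁ ℓ ≡ true → Role ℓ
        in-S₂ : ℓ ≢ i → ℓ ≢ j → inS₁ ℓ ≡ false → Role ℓ

      role : ∀ ℓ → Role ℓ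
      role ℓ with ℓ ≟ i | ℓ ≟ j
      ... | yes ℓ≡i | _ = is-i ℓ≡i
      ... | no _ | yes ℓ≡j = is-j ℓ≡j
      ... | no ℓ≢i | no ℓ≢j with inS₁ ℓ in ℓ∈?
      ...   | true = in-S₁ ℓ≢i ℓ≢j ℓ∈?
      ...   | false = in-S₂ ℓ≢i ℓ≢j ℓ∈?

      shape : ∀ {ℓ} → Role ℓ → Maybe (Fin 4)
      shape (is-i _) = just zero
      shape (is-j _) = just (suc zero)
      shape (in-S₁ _ _ _) = just (suc (suc zero))
      shape (in-S₂ _ _ _) = just (suc (suc (suc zero)))

      σ-of : ∀ {ℓ} (ρ : Role ℓ) → Lin (dimW* Ψ (shape ρ)) (dimW Φ ℓ)
      σ-of (is-i _) = id₁
      σ-of (is-j _) = id₁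
      σ-of {ℓ} (in-S₁ _ _ _) = columns-xyw (φ Φ ℓ ∘L map)
      σ-of {ℓ} (in-S₂ _ _ _) = columns-xyz (φ Φ ℓ ∘L map)

      square : ∀ {ℓ} (ρ : Role ℓ) → (σ-of ρ ∘L φ* Ψ (shape ρ)) ≈L (φ Φ ℓ ∘L map)
      square (is-i refl) r s = trans (identity-square id₁ (id₁-isId ei) refl (φ Ψ zero) r s)
        (sym (single-row ei (φ Φ i ∘L map) row-i r s))
      square (is-j refl) r s = trans (identity-square id₁ (id₁-isId ej) refl (φ Ψ (suc zero)) r s)
        (sym (single-row ej (φ Φ j ∘L map) row-j r s))
      square {ℓ} (in-S₁ ℓ≢i ℓ≢j ℓ∈S₁) = columns-xyw∘φ₃ (φ Φ ℓ ∘L map) (kills-z ℓ ℓ≢i ℓ≢j ℓ∈S₁)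
      square {ℓ} (in-S₂ ℓ≢i ℓ≢j ℓ∈S₂) = columns-xyz∘φ₄ (φ Φ ℓ ∘L map) (kills-w ℓ ℓ≢i ℓ≢j ℓ∈S₂)

      Θ : Morphism Ψ Φ
      Θ = record
        { α = λ ℓ → shape (role ℓ) ; θ = map ; σ = λ ℓ → σ-of (role ℓ) ; comm = λ ℓ → square (role ℓ) }

      at-i : ∀ {ℓ} (ρ : Role ℓ) → ℓ ≡ i → shape ρ ≡ just zero × IsId (σ-of ρ)
      at-i (is-i refl) _ = refl , id₁-isId ei
      at-i (is-j refl) j≡i = contradiction (sym j≡i) i≢j
      at-i (in-S₁ ℓ≢i _ _) ℓ≡i = contradiction ℓ≡i ℓ≢i
      at-i (in-S₂ ℓ≢i _ _) ℓ≡i = contradiction ℓ≡i ℓ≢i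

      at-j : ∀ {ℓ} (ρ : Role ℓ) → ℓ ≡ j → shape ρ ≡ just (suc zero) × IsId (σ-of ρ)
      at-j (is-i refl) i≡j = contradiction i≡j i≢j
      at-j (is-j refl) _ = refl , id₁-isId ej
      at-j (in-S₁ _ ℓ≢j _) ℓ≡j = contradiction ℓ≡j ℓ≢j
      at-j (in-S₂ _ ℓ≢j _) ℓ≡j = contradiction ℓ≡j ℓ≢j

      off-i : ∀ {ℓ} (ρ : Role ℓ) → ℓ ≢ i → shape ρ ≢ just zero
      off-i (is-i ℓ≡i) ℓ≢i _ = ℓ≢i ℓ≡i
      off-i (is-j _) _ ()
      off-i (in-S₁ _ _ _) _ ()
      off-i (in-S₂ _ _ _) _ ()

      off-j : ∀ {ℓ} (ρ : Role ℓ) → ℓ ≢ j → shape ρ ≢ just (suc zero)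
      off-j (is-i _) _ ()
      off-j (is-j ℓ≡j) ℓ≢j _ = ℓ≢j ℓ≡j
      off-j (in-S₁ _ _ _) _ ()
      off-j (in-S₂ _ _ _) _ ()

      respects : ∀ ℓ m → shape (role ℓ) ≡ just m × IsId (σ-of (role ℓ)) →
                 (∀ {ℓ′} (ρ : Role ℓ′) → ℓ′ ≢ ℓ → shape ρ ≢ just m) → Respects Θ ℓ
      respects ℓ m (shape≡m , idσ) off =
        (m , shape≡m) , (λ ℓ′ ℓ′≢ℓ e → off (role ℓ′) ℓ′≢ℓ (trans e shape≡m)) , idσ

      admissible⇒morphism : RespectingMorphism
      admissible⇒morphism =
        Θ , respects i zero (at-i (role i) refl) off-i , respects j (suc zero) (at-j (role j) refl) off-j
          , proj₁ (at-i (role i) refl) , proj₁ (at-j (role j) refl)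

lemma3p10 : (p : ℕ) .{{_ : NonZero p}} → Prime p → (a : ℤ) →
    let open Over p in
    (Φ : Datum) → (i j : Fin (k Φ)) → (ei : dimW Φ i ≡ 1) → (ej : dimW Φ j ≡ 1) →
    (Σ (Fin (k Φ) → Bool) λ inS1 →
      Σ (Lin 2 (dimV Φ)) λ μ0 →
      Σ (Lin 1 (dimV Φ)) λ μ1 →
      Σ (Lin 1 (dimV Φ)) λ μ2 →
        (∀ u → app (φ Φ i) (app μ0 u) (coord ei) ≡ u zero
             × app (φ Φ j) (app μ0 u) (coord ej) ≡ u (suc zero))
        × (∀ x → app (φ Φ i) (app μ1 x) (coord ei) ≡ ⟦ a ⟧ *F x zero
             × app (φ Φ j) (app μ1 x) (coord ej) ≡ x zero)
        × (∀ x → app (φ Φ i) (app μ2 x) (coord ei) ≡ x zero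
             × app (φ Φ j) (app μ2 x) (coord ej) ≡ ⟦ a ⟧ *F x zero)
        × (∀ ℓ → ℓ ≢ i → ℓ ≢ j → inS1 ℓ ≡ true → (φ Φ ℓ ∘L μ1) ≈L zeroL)
        × (∀ ℓ → ℓ ≢ i → ℓ ≢ j → inS1 ℓ ≡ false → (φ Φ ℓ ∘L μ2) ≈L zeroL))
    ⇔
    (Σ (Morphism (Ψa ⟦ a ⟧) Φ) λ Θ →
        Respects Θ i × Respects Θ j
        × α Θ i ≡ just zero × α Θ j ≡ just (suc zero))
lemma3p10 p p-prime a Φ i j ei ej = mk⇔
  (λ S → admissible⇒morphism (splitting⇒distinct 1F≢0F S) (splitting⇒admissible S))
  (λ R → admissible⇒splitting (morphism⇒admissible R))
  where
    open MorphismsFromΨa p (Over.⟦_⟧ p a)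
    open Conditions Φ i j ei ej
    1F≢0F : Over.1F p ≢ Over.0F p
    1F≢0F = ModularArithmetic.1F≢0F p (ℕ.nonTrivial⇒n>1 p {{prime⇒nonTrivial p-prime}})
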